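{- The formula classification of the inverse image relation classification is the inverse image classification of the formula relation classification: $\widehat{r^{ -1}(\mathcal{R}_1)} = \widehat{\langle R_2, K_1, \models_r\rangle} = \langle \widehat{R}_2, K_1, \models_{\hat r}\rangle = \hat r^{ -1}(\widehat{\mathcal{R}}_1)$.
   Context: Let $\langle r, f\rangle : \mathcal{S}_2 = \langle R_2, \sigma_2, X_2\rangle \Rightarrow \langle R_1, \sigma_1, X_1\rangle = \mathcal{S}_1$ be a schema morphism ($f : X_2 \to X_1$, $r : R_2 \to R_1$ preserving type lists) and let $\mathcal{M}_1 = \langle \mathcal{R}_1, \langle \sigma_1, \tau_1\rangle, \mathcal{E}_1\rangle$ be an $\mathcal{S}_1$-structure with relation classification $\mathcal{R}_1 = \langle R_1, K_1, \models_{\mathcal{R}_1}\rangle$, entity classification $\mathcal{E}_1 = \langle X_1, Y_1, \models_{\mathcal{E}_1}\rangle$ and key-to-tuple map $\tau_1 : K_1 \to \mathbf{List}(Y_1)$. The inverse image relation classification is $r^{ -1}(\mathcal{R}_1) = \langle R_2, K_1, \models_r\rangle$ with $k_1 \models_r r_2$ iff $k_1 \models_{\mathcal{R}_1} r(r_2)$; it is the relation classification of the inverse image $\mathcal{S}_2$-structure $\langle r^{ -1}(\mathcal{R}_1), \langle\sigma_2, \tau_1\rangle, f^{ -1}(\mathcal{E}_1)\rangle$. For any structure, the formula classification $\widehat{\mathcal{R}} = \langle \widehat{R}, K, \models_{\widehat{\mathcal{R}}}\rangle$ extends the relation classification to all formulas (built by meet, join, negation, implication $\varphi \to \psi$, difference,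 existential/universal quantification and substitution along type list morphisms), defined inductively: e.g. $k \models (\varphi \to \psi)$ iff ($k \models \varphi$ implies $k \models \psi$), and $k \models \Sigma_h(\varphi)$ iff $\tau(k) \in \exists_h(\wp\tau(\mathit{ext}(\varphi)))$, similarly for $\Pi_h$ and $h^{*}$. The map $\hat r : \widehat{R}_2 \to \widehat{R}_1$ is the recursive extension of $r$ to formulas (commuting with all connectives, quantifiers and substitution), and $\hat r^{ -1}(\widehat{\mathcal{R}}_1) = \langle \widehat{R}_2, K_1, \models_{\hat r}\rangle$ with $k_1 \models_{\hat r} \varphi_2$ iff $k_1 \models_{\widehat{\mathcal{R}}_1} \hat r(\varphi_2)$. -}

module Defs where

open import Data.Nat using (ℕ; zero; suc)
open import Data.Fin using (Fin)
open import Data.Vec using (Vec; []; _∷_; lookup; map; tabulate)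
open import Data.Vec.Properties using (lookup-map)
open import Data.Vec.Relation.Binary.Pointwise.Inductive using (Pointwise; []; _∷_)
open import Data.Product using (Σ; _×_; _,_; proj₁; proj₂)
open import Relation.Binary.PropositionalEquality using (_≡_; refl; sym; trans; cong; subst)
open import Relation.Nullary using (¬_)
open import Data.Sum using (_⊎_)

-- List(A) = { ⟨n, a⟩ | n ∈ ℕ, a : n → A }  (arity + tuple, as a vector)

Lst : Set → Set
Lst A = Σ ℕ (Vec A)

lmap : {A B : Set} → (A → B) → Lst A → Lst B
lmap f (n , v) = n , map f v

record Classification : Set₁ where
  field
    Typ : Set
    Ins : Set
    _⊨_ : Ins → Typ → Set

invImg : {A : Set} (C : Classification) → (A → Classification.Typ C) → Classification
invImg {A} C g = record
  { Typ = A
  ; Ins = Classification.Ins C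
  ; _⊨_ = λ i a → Classification._⊨_ C i (g a) }

record TLMor {X : Set} (s' s : Lst X) : Set where
  field
    arr  : Fin (proj₁ s') → Fin (proj₁ s)
    comm : ∀ i → lookup (proj₂ s) (arr i) ≡ lookup (proj₂ s') i
open TLMor public

mapTLMor : {X X' : Set} (f : X → X') {s' s : Lst X} → TLMor s' s → TLMor (lmap f s') (lmap f s)
mapTLMor f {n' , xs'} {n , xs} h = record
  { arr  = arr h
  ; comm = λ i → trans (lookup-map (arr h i) f xs)
                   (trans (cong f (comm h i)) (sym (lookup-map i f xs'))) }

TupV : {X Y : Set} (_⊨_ : Y → X → Set) (s : Lst X) → Vec Y (proj₁ s) → Set
TupV _⊨_ s t = Pointwise _⊨_ t (proj₂ s)

InTup : {X Y : Set} (_⊨_ : Y → X → Set) (s : Lst X) → Lst Y → Set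
InTup {Y = Y} _⊨_ s l = Σ (Vec Y (proj₁ s)) λ t → (l ≡ (proj₁ s , t)) × TupV _⊨_ s t

restr : {X Y : Set} {s' s : Lst X} → TLMor s' s → Vec Y (proj₁ s) → Vec Y (proj₁ s')
restr h t = tabulate (λ i → lookup t (arr h i))

exImg : {X Y : Set} (_⊨_ : Y → X → Set) {s' s : Lst X} → TLMor s' s → (Lst Y → Set) → Lst Y → Set
exImg {Y = Y} _⊨_ {s'} {s} h A l' =
  Σ (Vec Y (proj₁ s)) λ t → TupV _⊨_ s t × A (proj₁ s , t) × (l' ≡ (proj₁ s' , restr h t))

allImg : {X Y : Set} (_⊨_ : Y → X → Set) {s' s : Lst X} → TLMor s' s → (Lst Y → Set) → Lst Y → Set
allImg {Y = Y} _⊨_ {s'} {s} h A l' =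
  InTup _⊨_ s' l' ×
  ((t : Vec Y (proj₁ s)) → TupV _⊨_ s t → l' ≡ (proj₁ s' , restr h t) → A (proj₁ s , t))

invImgTup : {X Y : Set} (_⊨_ : Y → X → Set) {s' s : Lst X} → TLMor s' s → (Lst Y → Set) → Lst Y → Set
invImgTup {Y = Y} _⊨_ {s'} {s} h A l =
  Σ (Vec Y (proj₁ s)) λ t → (l ≡ (proj₁ s , t)) × TupV _⊨_ s t × A (proj₁ s' , restr h t)

record Schema : Set₁ where
  field
    Rel  : Set
    Sort : Set
    sig  : Rel → Lst Sort
open Schema public

record SchemaMorphism (S₂ S₁ : Schema) : Set where
  field
    fun  : Sort S₂ → Sort S₁
    rel  : Rel S₂ → Rel S₁
    pres : ∀ ρ → sig S₁ (rel ρ) ≡ lmap fun (sig S₂ ρ)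
open SchemaMorphism public

data Fml {X R : Set} (σ : R → Lst X) : Lst X → Set where
  atom : ∀ {s} (ρ : R) → σ ρ ≡ s → Fml σ s
  _∧f_ _∨f_ _⇒f_ _∖f_ : ∀ {s} → Fml σ s → Fml σ s → Fml σ s
  ¬f   : ∀ {s} → Fml σ s → Fml σ s
  Σf   : ∀ {s' s} → TLMor s' s → Fml σ s → Fml σ s'
  Πf   : ∀ {s' s} → TLMor s' s → Fml σ s → Fml σ s'
  subf : ∀ {s' s} → TLMor s' s → Fml σ s' → Fml σ s

FmlSet : Schema → Set
FmlSet S = Σ (Lst (Sort S)) (Fml (sig S))

record Structure (S : Schema) : Set₁ where
  field
    Key  : Set
    Ent  : Set
    _⊨ᴿ_ : Key → Rel S → Set
    _⊨ᴱ_ : Ent → Sort S → Set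
    τ    : Key → Lst Ent
    compat : ∀ k ρ → k ⊨ᴿ ρ → InTup _⊨ᴱ_ (sig S ρ) (τ k)
open Structure public

relClass : {S : Schema} → Structure S → Classification
relClass {S} M = record { Typ = Rel S ; Ins = Key M ; _⊨_ = _⊨ᴿ_ M }

entClass : {S : Schema} → Structure S → Classification
entClass {S} M = record { Typ = Sort S ; Ins = Ent M ; _⊨_ = _⊨ᴱ_ M }

sat : {S : Schema} (M : Structure S) {s : Lst (Sort S)} → Key M → Fml (sig S) s → Set
sat M k (atom ρ _) = _⊨ᴿ_ M k ρ
sat M k (φ ∧f ψ)   = sat M k φ × sat M k ψ
sat M k (φ ∨f ψ)   = sat M k φ ⊎ sat M k ψ
sat M k (φ ⇒f ψ)   = sat M k φ → sat M k ψ
sat M k (φ ∖f ψ)   = sat M k φ × ¬ sat M k ψ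
sat M k (¬f φ)     = ¬ sat M k φ
sat M k (Σf h φ)   =
  exImg (_⊨ᴱ_ M) h (λ l → Σ (Key M) λ k' → sat M k' φ × (τ M k' ≡ l)) (τ M k)
sat M k (Πf h φ)   =
  allImg (_⊨ᴱ_ M) h (λ l → Σ (Key M) λ k' → sat M k' φ × (τ M k' ≡ l)) (τ M k)
sat M k (subf h φ) =
  invImgTup (_⊨ᴱ_ M) h (λ l → Σ (Key M) λ k' → sat M k' φ × (τ M k' ≡ l)) (τ M k)

fmlClass : {S : Schema} → Structure S → Classification
fmlClass {S} M = record
  { Typ = FmlSet S
  ; Ins = Key M
  ; _⊨_ = λ k φ → sat M k (proj₂ φ) }

rhatF : {S₂ S₁ : Schema} (m : SchemaMorphism S₂ S₁) {s : Lst (Sort S₂)} →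
        Fml (sig S₂) s → Fml (sig S₁) (lmap (fun m) s)
rhatF m (atom ρ e)  = atom (rel m ρ) (trans (pres m ρ) (cong (lmap (fun m)) e))
rhatF m (φ ∧f ψ)    = rhatF m φ ∧f rhatF m ψ
rhatF m (φ ∨f ψ)    = rhatF m φ ∨f rhatF m ψ
rhatF m (φ ⇒f ψ)    = rhatF m φ ⇒f rhatF m ψ
rhatF m (φ ∖f ψ)    = rhatF m φ ∖f rhatF m ψ
rhatF m (¬f φ)      = ¬f (rhatF m φ)
rhatF m (Σf h φ)    = Σf (mapTLMor (fun m) h) (rhatF m φ)
rhatF m (Πf h φ)    = Πf (mapTLMor (fun m) h) (rhatF m φ)
rhatF m (subf h φ)  = subf (mapTLMor (fun m) h) (rhatF m φ)

rhat : {S₂ S₁ : Schema} (m : SchemaMorphism S₂ S₁) → FmlSet S₂ → FmlSet S₁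
rhat m (s , φ) = lmap (fun m) s , rhatF m φ

pw-unmap : {X X' Y : Set} {R : Y → X' → Set} (f : X → X') {n : ℕ}
           {t : Vec Y n} {xs : Vec X n} →
           Pointwise R t (map f xs) → Pointwise (λ y x → R y (f x)) t xs
pw-unmap f {xs = []} [] = []
pw-unmap f {xs = x ∷ xs} (p ∷ ps) = p ∷ pw-unmap f ps

inTup-unmap : {X X' Y : Set} {R : Y → X' → Set} (f : X → X') (s : Lst X) (l : Lst Y) →
              InTup R (lmap f s) l → InTup (λ y x → R y (f x)) s l
inTup-unmap f (n , xs) l (t , e , p) = t , e , pw-unmap f p

invStr : {S₂ S₁ : Schema} → SchemaMorphism S₂ S₁ → Structure S₁ → Structure S₂
invStr {S₂} {S₁} m M = record
  { Key  = Key M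
  ; Ent  = Ent M
  ; _⊨ᴿ_ = λ k ρ → _⊨ᴿ_ M k (rel m ρ)
  ; _⊨ᴱ_ = λ y x → _⊨ᴱ_ M y (fun m x)
  ; τ    = τ M
  ; compat = λ k ρ p → inTup-unmap (fun m) (sig S₂ ρ) (τ M k)
               (subst (λ s → InTup (_⊨ᴱ_ M) s (τ M k)) (pres m ρ) (compat M k (rel m ρ) p)) }

-- Every formula constructor of the inverse image structure is interpreted by the same
-- operation on the same keys and entity tuples as its r̂-image in 𝓜₁: keys, the tuple map τ₁
-- and the entities are shared, and an entity tuple lies in Tup(s) for f⁻¹(ℰ₁) exactly when
-- it lies in Tup(List(f) s) for ℰ₁. Hence the existential, universal and inverse images
-- along h and along List(f) h agree on agreeing extents, and satisfaction is preserved by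
-- induction on the formula.
module Submission where

open import Defs
open import Data.Nat using (ℕ)
open import Data.Vec using (Vec; map)
open import Data.Vec.Relation.Binary.Pointwise.Inductive using (Pointwise; []; _∷_)
open import Data.Product using (Σ; _×_; _,_)
open import Data.Product.Function.NonDependent.Propositional using (_×-⇔_)
open import Data.Sum.Function.Propositional using (_⊎-⇔_)
open import Function.Bundles using (_⇔_; mk⇔; Equivalence)
open import Function.Construct.Identity using (⇔-id)
open import Function.Related.TypeIsomorphisms using (→-cong-⇔; ¬-cong-⇔)
open import Relation.Binary.PropositionalEquality using (_≡_)

open Equivalence using (to; from)

pw-map : {X X' Y : Set} {R : Y → X' → Set} (f : X → X') {n : ℕ}
         {t : Vec Y n} {xs : Vec X n} →
         Pointwise (λ y x → R y (f x)) t xs → Pointwise R t (map f xs)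
pw-map f []       = []
pw-map f (p ∷ ps) = p ∷ pw-map f ps

Pointwise-map⇔ : {X X' Y : Set} {R : Y → X' → Set} (f : X → X') {n : ℕ}
                 {t : Vec Y n} {xs : Vec X n} →
                 Pointwise (λ y x → R y (f x)) t xs ⇔ Pointwise R t (map f xs)
Pointwise-map⇔ f = mk⇔ (pw-map f) (pw-unmap f)

module _ {X X' Y : Set} {R : Y → X' → Set} (f : X → X') where

  private
    R∘f : Y → X → Set
    R∘f y x = R y (f x)

  InTup-lmap⇔ : ∀ (s : Lst X) l → InTup R∘f s l ⇔ InTup R (lmap f s) l
  InTup-lmap⇔ s l = mk⇔
    (λ (t , e , p) → t , e , to (Pointwise-map⇔ f) p)
    (λ (t , e , p) → t , e , from (Pointwise-map⇔ f) p)

  module _ {s' s : Lst X} (h : TLMor s' s) {A B : Lst Y → Set} (A⇔B : ∀ l → A l ⇔ B l) where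

    exImg-lmap⇔ : ∀ l → exImg R∘f h A l ⇔ exImg R (mapTLMor f h) B l
    exImg-lmap⇔ l = mk⇔
      (λ (t , p , a , e) → t , to (Pointwise-map⇔ f) p , to (A⇔B _) a , e)
      (λ (t , p , b , e) → t , from (Pointwise-map⇔ f) p , from (A⇔B _) b , e)

    allImg-lmap⇔ : ∀ l → allImg R∘f h A l ⇔ allImg R (mapTLMor f h) B l
    allImg-lmap⇔ l = mk⇔
      (λ (l∈ , all) → to (InTup-lmap⇔ s' l) l∈ ,
                      λ t p e → to (A⇔B _) (all t (from (Pointwise-map⇔ f) p) e))
      (λ (l∈ , all) → from (InTup-lmap⇔ s' l) l∈ ,
                      λ t p e → from (A⇔B _) (all t (to (Pointwise-map⇔ f) p) e))

    invImgTup-lmap⇔ : ∀ l → invImgTup R∘f h A l ⇔ invImgTup R (mapTLMor f h) B l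
    invImgTup-lmap⇔ l = mk⇔
      (λ (t , e , p , a) → t , e , to (Pointwise-map⇔ f) p , to (A⇔B _) a)
      (λ (t , e , p , b) → t , e , from (Pointwise-map⇔ f) p , from (A⇔B _) b)

-- The paper's ℘τ(ext(φ)), the set inlined in the clauses of sat for Σf, Πf and subf.
extent : {S : Schema} (M : Structure S) {s : Lst (Sort S)} → Fml (sig S) s → Lst (Ent M) → Set
extent M φ l = Σ (Key M) λ k → sat M k φ × (τ M k ≡ l)

module _ {S₂ S₁ : Schema} (m : SchemaMorphism S₂ S₁) (M₁ : Structure S₁) where

  sat-invStr⇔ : ∀ {s} (φ : Fml (sig S₂) s) k → sat (invStr m M₁) k φ ⇔ sat M₁ k (rhatF m φ)
  extent-invStr⇔ : ∀ {s} (φ : Fml (sig S₂) s) l →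
                   extent (invStr m M₁) φ l ⇔ extent M₁ (rhatF m φ) l

  sat-invStr⇔ (atom ρ _) k = ⇔-id _
  sat-invStr⇔ (φ ∧f ψ) k   = sat-invStr⇔ φ k ×-⇔ sat-invStr⇔ ψ k
  sat-invStr⇔ (φ ∨f ψ) k   = sat-invStr⇔ φ k ⊎-⇔ sat-invStr⇔ ψ k
  sat-invStr⇔ (φ ⇒f ψ) k   = →-cong-⇔ (sat-invStr⇔ φ k) (sat-invStr⇔ ψ k)
  sat-invStr⇔ (φ ∖f ψ) k   = sat-invStr⇔ φ k ×-⇔ ¬-cong-⇔ (sat-invStr⇔ ψ k)
  sat-invStr⇔ (¬f φ) k     = ¬-cong-⇔ (sat-invStr⇔ φ k)
  sat-invStr⇔ (Σf h φ) k   = exImg-lmap⇔ (fun m) h (extent-invStr⇔ φ) (τ M₁ k)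
  sat-invStr⇔ (Πf h φ) k   = allImg-lmap⇔ (fun m) h (extent-invStr⇔ φ) (τ M₁ k)
  sat-invStr⇔ (subf h φ) k = invImgTup-lmap⇔ (fun m) h (extent-invStr⇔ φ) (τ M₁ k)

  extent-invStr⇔ φ l = mk⇔
    (λ (k , sat₂ , e) → k , to (sat-invStr⇔ φ k) sat₂ , e)
    (λ (k , sat₁ , e) → k , from (sat-invStr⇔ φ k) sat₁ , e)

mainTheorem3 : (S₂ S₁ : Schema) (m : SchemaMorphism S₂ S₁) (M₁ : Structure S₁) →
    (k : Classification.Ins (fmlClass (invStr m M₁))) (φ : Classification.Typ (fmlClass (invStr m M₁))) →
    Classification._⊨_ (fmlClass (invStr m M₁)) k φ ⇔ Classification._⊨_ (invImg (fmlClass M₁) (rhat m)) k φ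
mainTheorem3 S₂ S₁ m M₁ k (s , φ) = sat-invStr⇔ m M₁ φ k
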